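{- Let $G=(V,E)$ be a finite, simple, undirected, connected graph with at least two vertices, and let $X \subseteq V$ with $|X| = 1$ be such that $G[V\setminus X]$ is a disjoint union of cliques. Then $\chi_{ON}(G) \leq 3$.
   Context: A CFON coloring of a graph $G=(V,E)$ with $k$ colors is a map $C: V \to \{1,\dots,k\}$ such that for every $v \in V$ there is a color $i$ with $|N(v)\cap C^{ -1}(i)| = 1$, where $N(v)$ is the open neighborhood of $v$. $\chi_{ON}(G)$ is the minimum $k$ for which a CFON coloring with $k$ colors exists. -}

module Defs where

open import Data.Nat using (ℕ; suc; _≤_)
open import Data.Fin using (Fin)
open import Data.Fin.Properties using (_≟_)
open import Data.List using (List; length; filter; allFin)
open import Data.Product using (Σ; ∃; _×_; _,_)
open import Data.Empty using (⊥)
open import Relation.Nullary using (¬_; Dec)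
open import Relation.Nullary.Decidable using (_×-dec_)
open import Relation.Binary.PropositionalEquality using (_≡_)

record Graph (n : ℕ) : Set₁ where
  field
    Adj     : Fin n → Fin n → Set
    adj?    : ∀ u v → Dec (Adj u v)
    irrefl  : ∀ v → ¬ Adj v v
    sym     : ∀ {u v} → Adj u v → Adj v u
open Graph public

data Reach {n : ℕ} (G : Graph n) : Fin n → Fin n → Set where
  here : ∀ {v} → Reach G v v
  step : ∀ {u w v} → Adj G u w → Reach G w v → Reach G u v

Connected : ∀ {n} → Graph n → Set
Connected {n} G = ∀ (u v : Fin n) → Reach G u v

countNbrCol : ∀ {n k} (G : Graph n) (C : Fin n → Fin k) (v : Fin n) (i : Fin k) → ℕ
countNbrCol {n} G C v i =
  length (filter (λ u → adj? G v u ×-dec (C u ≟ i)) (allFin n))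

IsCFON : ∀ {n} (G : Graph n) (k : ℕ) → (Fin n → Fin k) → Set
IsCFON {n} G k C = ∀ (v : Fin n) → ∃ λ (i : Fin k) → countNbrCol G C v i ≡ 1

-- χ_ON(G) ≤ k : some CFON colouring with at most k colours exists
-- (equivalently with exactly the palette {1..k}, colours may be unused).
χON≤ : ∀ {n} → Graph n → ℕ → Set
χON≤ {n} G k = Σ ℕ λ m → m ≤ k × Σ (Fin n → Fin m) (IsCFON G m)

-- G[V ∖ {x}] is a disjoint union of cliques: there is a labelling of the
-- vertices other than x by clique indices such that two distinct vertices
-- other than x are adjacent iff they lie in the same clique.
DisjointUnionOfCliquesWithout : ∀ {n} → Graph n → Fin n → Set
DisjointUnionOfCliquesWithout {n} G x =
  Σ (Fin n → ℕ) λ part →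
    ∀ (u v : Fin n) → ¬ u ≡ x → ¬ v ≡ x → ¬ u ≡ v →
      (Adj G u v → part u ≡ part v) × (part u ≡ part v → Adj G u v)

-- Colour x with A and a neighbour u of x with B; the rest of u's clique gets C.  In every other
-- clique K with a vertex outside N(x), colour one such vertex t (the hub) with B, one vertex
-- r ∈ K ∩ N(x) (the relay, which exists by connectivity) with A and the rest with C; a clique
-- inside N(x) is coloured C throughout.  Then x sees B only at u, u sees A only at x, the rest of
-- u's clique sees B only at u, a hub sees A only at its relay, the rest of its clique sees B only
-- at the hub, and a clique inside N(x) sees A only at x.  Hubs lie outside N(x), so x sees no
-- other B.
module Submission where

open import Defs hiding (sym)
open import Data.Bool using (if_then_else_)
open import Data.Empty using (⊥-elim)
open import Data.Fin using (Fin; zero; suc)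
open import Data.Fin.Properties using (_≟_; any?; 0≢1+n; suc-injective)
open import Data.List using (length; filter; tabulate; _∷_)
open import Data.List.Properties using (filter-accept; filter-reject; filter-none)
open import Data.List.Relation.Unary.All.Properties using (tabulate⁺)
open import Data.Maybe using (Maybe; just; nothing)
open import Data.Maybe.Properties using (just-injective; ≡-dec)
open import Data.Nat using (ℕ; zero; suc; s≤s; _≤_)
import Data.Nat as ℕ
open import Data.Nat.Properties using (≤-refl)
open import Data.Product using (∃; _×_; _,_; proj₁; proj₂)
open import Data.Sum using (_⊎_; inj₁; inj₂)
open import Function using (id; _∘_)
open import Relation.Nullary using (¬_; yes; no; does; ¬?)
open import Relation.Nullary.Decidable using (_×-dec_)
open import Relation.Unary using (Pred; Decidable)
open import Relation.Binary.PropositionalEquality using (_≡_; _≢_; refl; sym; trans; cong)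

filter-tabulate-unique : ∀ {a p} {A : Set a} {P : Pred A p} (P? : Decidable P) {n} (f : Fin n → A)
                         (i : Fin n) → P (f i) → (∀ j → P (f j) → j ≡ i) →
                         length (filter P? (tabulate f)) ≡ 1
filter-tabulate-unique P? f zero Pfi unique =
  cong length (trans (filter-accept P? Pfi) (cong (f zero ∷_) (filter-none P? outside-zero)))
  where outside-zero = tabulate⁺ {f = f ∘ suc} λ j Pfj → 0≢1+n (sym (unique (suc j) Pfj))
filter-tabulate-unique P? f (suc i) Pfi unique =
  trans (cong length (filter-reject P? (λ Pf0 → 0≢1+n (unique zero Pf0))))
        (filter-tabulate-unique P? (f ∘ suc) i Pfi (λ j Pfj → suc-injective (unique (suc j) Pfj)))

countNbrCol≡1 : ∀ {n k} (G : Graph n) (C : Fin n → Fin k) {v w : Fin n} {i : Fin k} →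
                Adj G v w → C w ≡ i → (∀ w′ → Adj G v w′ → C w′ ≡ i → w′ ≡ w) →
                countNbrCol G C v i ≡ 1
countNbrCol≡1 G C {v} {w} {i} vw Cw≡i unique =
  filter-tabulate-unique (λ u → adj? G v u ×-dec (C u ≟ i)) id w (vw , Cw≡i)
                         (λ w′ (vw′ , Cw′≡i) → unique w′ vw′ Cw′≡i)

select : ∀ {n p} {P : Pred (Fin n) p} → Decidable P → Maybe (Fin n)
select P? with any? P?
... | yes (w , _) = just w
... | no _        = nothing

module _ {n p} {P : Pred (Fin n) p} (P? : Decidable P) where

  select-sound : ∀ {w} → select P? ≡ just w → P w
  select-sound eq with any? P?
  select-sound refl | yes (_ , Pw) = Pw

  select-complete : ∀ {w} → P w → ∃ λ w′ → select P? ≡ just w′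
  select-complete Pw with any? P?
  ... | yes (w′ , _) = w′ , refl
  ... | no ¬∃P       = ⊥-elim (¬∃P (_ , Pw))

  select-nothing : ∀ {w} → select P? ≡ nothing → ¬ P w
  select-nothing eq Pw with select-complete Pw
  ... | _ , eq′ with () ← trans (sym eq) eq′

adj⇒≢ : ∀ {n} (G : Graph n) {u v : Fin n} → Adj G u v → u ≢ v
adj⇒≢ G {u} uv refl = irrefl G u uv

∃-neighbour : ∀ {n} (G : Graph n) {u v : Fin n} → u ≢ v → Reach G u v → ∃ (Adj G u)
∃-neighbour G u≢v here              = ⊥-elim (u≢v refl)
∃-neighbour G u≢v (step {w = w} uw _) = w , uw

∃-other : ∀ {m} (x : Fin (suc (suc m))) → ∃ λ y → x ≢ y
∃-other zero    = suc zero , λ ()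
∃-other (suc _) = zero , λ ()

pattern A = zero
pattern B = suc zero
pattern C = suc (suc zero)

classColour : ∀ {n} → Maybe (Fin n) → Maybe (Fin n) → Fin n → Fin 3
classColour nothing  r w = C
classColour (just t) r w =
  if does (w ≟ t) then B else if does (≡-dec _≟_ r (just w)) then A else C

classColour≡B : ∀ {n} (h r : Maybe (Fin n)) (w : Fin n) → classColour h r w ≡ B → h ≡ just w
classColour≡B nothing r w ()
classColour≡B (just t) r w eq with w ≟ t | ≡-dec _≟_ r (just w)
... | yes refl | _ = refl
classColour≡B (just t) r w () | no _ | yes _
classColour≡B (just t) r w () | no _ | no _

classColour≡A : ∀ {n} (h r : Maybe (Fin n)) (w : Fin n) →
                classColour h r w ≡ A → h ≢ nothing × r ≡ just w
classColour≡A nothing r w ()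
classColour≡A (just t) r w eq with w ≟ t | ≡-dec _≟_ r (just w)
classColour≡A (just t) r w () | yes _ | _
... | no _ | yes r≡w = (λ ()) , r≡w
classColour≡A (just t) r w () | no _ | no _

classColour-hub : ∀ {n} {r : Maybe (Fin n)} (t : Fin n) → classColour (just t) r t ≡ B
classColour-hub t with t ≟ t
... | yes _   = refl
... | no t≢t = ⊥-elim (t≢t refl)

classColour-relay : ∀ {n} {t r : Fin n} → r ≢ t → classColour (just t) (just r) r ≡ A
classColour-relay {t = t} {r} r≢t with r ≟ t | r ≟ r
... | yes r≡t | _       = ⊥-elim (r≢t r≡t)
... | no _    | yes _   = refl
... | no _    | no r≢r = ⊥-elim (r≢r refl)

module CliquesBesides {n} (G : Graph n) (x : Fin n) (part : Fin n → ℕ)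
       (cliques : ∀ (a b : Fin n) → a ≢ x → b ≢ x → a ≢ b →
                  (Adj G a b → part a ≡ part b) × (part a ≡ part b → Adj G a b)) where

  adj⇒sameClass : ∀ {a b} → a ≢ x → b ≢ x → Adj G a b → part a ≡ part b
  adj⇒sameClass a≢x b≢x ab = proj₁ (cliques _ _ a≢x b≢x (adj⇒≢ G ab)) ab

  sameClass⇒adj : ∀ {a b} → a ≢ x → b ≢ x → a ≢ b → part a ≡ part b → Adj G a b
  sameClass⇒adj a≢x b≢x a≢b = proj₂ (cliques _ _ a≢x b≢x a≢b)

  x-adj⇒≢ : ∀ {w} → Adj G x w → w ≢ x
  x-adj⇒≢ xw = adj⇒≢ G xw ∘ sym

  -- A walk from v to x stays in the clique of v until its last step.
  class-meets-N[x] : ∀ {v} → v ≢ x → Reach G v x → ∃ λ w → part w ≡ part v × Adj G x w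
  class-meets-N[x] v≢x here = ⊥-elim (v≢x refl)
  class-meets-N[x] {v} v≢x (step {w = w} vw w↝x) with w ≟ x
  ... | yes refl = v , refl , Graph.sym G vw
  ... | no w≢x with class-meets-N[x] w≢x w↝x
  ...   | r , rw , xr = r , trans rw (sym (adj⇒sameClass v≢x w≢x vw)) , xr

  Outside Inside : ℕ → Pred (Fin n) _
  Outside q w = part w ≡ q × w ≢ x × ¬ Adj G x w
  Inside  q w = part w ≡ q × Adj G x w

  hub relay : ℕ → Maybe (Fin n)
  hub   q = select λ w → (part w ℕ.≟ q) ×-dec (¬? (w ≟ x) ×-dec ¬? (adj? G x w))
  relay q = select λ w → (part w ℕ.≟ q) ×-dec adj? G x w

  chosen-unique : (f : ℕ → Maybe (Fin n)) {q q′ : ℕ} {a b : Fin n} →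
                  q ≡ q′ → f q ≡ just a → f q′ ≡ just b → a ≡ b
  chosen-unique f refl fa fb = just-injective (trans (sym fa) fb)

  hub-outside : ∀ {q w} → hub q ≡ just w → Outside q w
  hub-outside = select-sound _

  relay-inside : ∀ {q w} → relay q ≡ just w → Inside q w
  relay-inside = select-sound _

  module Colouring (connected : Connected G) (u : Fin n) (xu : Adj G x u) where

    u≢x : u ≢ x
    u≢x = x-adj⇒≢ xu

    colour : Fin n → Fin 3
    colour w with w ≟ x | part w ℕ.≟ part u
    ... | yes _ | _     = A
    ... | no _  | yes _ = if does (w ≟ u) then B else C
    ... | no _  | no _  = classColour (hub (part w)) (relay (part w)) w

    colour-x : colour x ≡ A
    colour-x with x ≟ x
    ... | yes _   = refl
    ... | no x≢x = ⊥-elim (x≢x refl)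

    colour-u : colour u ≡ B
    colour-u with u ≟ x | part u ℕ.≟ part u
    ... | yes u≡x | _     = ⊥-elim (u≢x u≡x)
    ... | no _    | no ne = ⊥-elim (ne refl)
    ... | no _    | yes _ with u ≟ u
    ...   | yes _ = refl
    ...   | no ne = ⊥-elim (ne refl)

    colour-classMember : ∀ {w q} → w ≢ x → part w ≡ q → q ≢ part u →
                         colour w ≡ classColour (hub q) (relay q) w
    colour-classMember {w} w≢x refl ne with w ≟ x | part w ℕ.≟ part u
    ... | yes w≡x | _    = ⊥-elim (w≢x w≡x)
    ... | no _    | yes e = ⊥-elim (ne e)
    ... | no _    | no _  = refl

    colour≡B : ∀ w → colour w ≡ B → w ≡ u ⊎ (w ≢ x × part w ≢ part u × hub (part w) ≡ just w)
    colour≡B w eq with w ≟ x | part w ℕ.≟ part u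
    colour≡B w () | yes _ | _
    ... | no w≢x | no ne = inj₂ (w≢x , ne , classColour≡B _ _ w eq)
    ... | no _   | yes _ with w ≟ u
    ...   | yes w≡u = inj₁ w≡u
    colour≡B w () | no _ | yes _ | no _

    colour≡A : ∀ w → colour w ≡ A →
               w ≡ x ⊎ (part w ≢ part u × hub (part w) ≢ nothing × relay (part w) ≡ just w)
    colour≡A w eq with w ≟ x | part w ℕ.≟ part u
    ... | yes w≡x | _ = inj₁ w≡x
    ... | no _ | no ne = inj₂ (ne , classColour≡A _ _ w eq)
    ... | no _ | yes _ with w ≟ u
    colour≡A w () | no _ | yes _ | yes _
    colour≡A w () | no _ | yes _ | no _

    colour-hub : ∀ {q t} → q ≢ part u → hub q ≡ just t → colour t ≡ B
    colour-hub {q} {t} ne hq with hub-outside hq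
    ... | pt , t≢x , _ rewrite colour-classMember t≢x pt ne | hq = classColour-hub {r = relay q} t

    colour-relay : ∀ {q t r} → q ≢ part u → hub q ≡ just t → relay q ≡ just r → colour r ≡ A
    colour-relay {t = t} {r} ne hq rq with hub-outside hq | relay-inside rq
    ... | _ , _ , ¬xt | pr , xr rewrite colour-classMember (x-adj⇒≢ xr) pr ne | hq | rq =
      classColour-relay {t = t} {r} λ { refl → ¬xt xr }

    x-sees-u : countNbrCol G colour x B ≡ 1
    x-sees-u = countNbrCol≡1 G colour xu colour-u unique
      where
      unique : ∀ w → Adj G x w → colour w ≡ B → w ≡ u
      unique w xw cw with colour≡B w cw
      ... | inj₁ w≡u = w≡u
      ... | inj₂ (_ , _ , hw) with hub-outside hw
      ...   | _ , _ , ¬xw = ⊥-elim (¬xw xw)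

    u-sees-x : countNbrCol G colour u A ≡ 1
    u-sees-x = countNbrCol≡1 G colour (Graph.sym G xu) colour-x unique
      where
      unique : ∀ w → Adj G u w → colour w ≡ A → w ≡ x
      unique w uw cw with colour≡A w cw
      ... | inj₁ w≡x = w≡x
      ... | inj₂ (ne , _ , rw) with relay-inside rw
      ...   | _ , xw = ⊥-elim (ne (adj⇒sameClass (x-adj⇒≢ xw) u≢x (Graph.sym G uw)))

    ownClass-sees-u : ∀ {v} → v ≢ x → part v ≡ part u → v ≢ u → countNbrCol G colour v B ≡ 1
    ownClass-sees-u v≢x e v≢u =
      countNbrCol≡1 G colour (sameClass⇒adj v≢x u≢x v≢u e) colour-u unique
      where
      unique : ∀ w → Adj G _ w → colour w ≡ B → w ≡ u
      unique w vw cw with colour≡B w cw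
      ... | inj₁ w≡u = w≡u
      ... | inj₂ (w≢x , ne , _) = ⊥-elim (ne (trans (adj⇒sameClass w≢x v≢x (Graph.sym G vw)) e))

    hubless-sees-x : ∀ {v} → v ≢ x → hub (part v) ≡ nothing → countNbrCol G colour v A ≡ 1
    hubless-sees-x {v} v≢x hv = countNbrCol≡1 G colour vx colour-x unique
      where
      vx : Adj G v x
      vx with adj? G x v
      ... | yes xv = Graph.sym G xv
      ... | no ¬xv = ⊥-elim (select-nothing _ hv (refl , v≢x , ¬xv))
      unique : ∀ w → Adj G v w → colour w ≡ A → w ≡ x
      unique w vw cw with colour≡A w cw
      ... | inj₁ w≡x = w≡x
      ... | inj₂ (_ , hasHub , rw) with relay-inside rw
      ...   | _ , xw =
        ⊥-elim (hasHub (trans (cong hub (adj⇒sameClass (x-adj⇒≢ xw) v≢x (Graph.sym G vw))) hv))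

    hub-sees-relay : ∀ {t} → part t ≢ part u → hub (part t) ≡ just t → countNbrCol G colour t A ≡ 1
    hub-sees-relay {t} ne ht with hub-outside ht
    ... | _ , t≢x , ¬xt with class-meets-N[x] t≢x (connected t x)
    ...   | r₀ , pr₀ , xr₀ with select-complete _ {r₀} (pr₀ , xr₀)
    ...     | r , rt with relay-inside rt
    ...       | pr , xr = countNbrCol≡1 G colour tr (colour-relay ne ht rt) unique
      where
      tr : Adj G t r
      tr = sameClass⇒adj t≢x (x-adj⇒≢ xr) (λ { refl → ¬xt xr }) (sym pr)
      unique : ∀ w → Adj G t w → colour w ≡ A → w ≡ r
      unique w tw cw with colour≡A w cw
      ... | inj₁ refl = ⊥-elim (¬xt (Graph.sym G tw))
      ... | inj₂ (_ , _ , rw) with relay-inside rw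
      ...   | _ , xw = chosen-unique relay (adj⇒sameClass (x-adj⇒≢ xw) t≢x (Graph.sym G tw)) rw rt

    sees-hub : ∀ {v t} → v ≢ x → part v ≢ part u → hub (part v) ≡ just t → v ≢ t →
               countNbrCol G colour v B ≡ 1
    sees-hub {v} {t} v≢x ne hv v≢t with hub-outside hv
    ... | pt , t≢x , _ =
      countNbrCol≡1 G colour (sameClass⇒adj v≢x t≢x v≢t (sym pt)) (colour-hub ne hv) unique
      where
      unique : ∀ w → Adj G v w → colour w ≡ B → w ≡ t
      unique w vw cw with colour≡B w cw
      ... | inj₁ refl = ⊥-elim (ne (adj⇒sameClass v≢x u≢x vw))
      ... | inj₂ (w≢x , _ , hw) = chosen-unique hub (adj⇒sameClass w≢x v≢x (Graph.sym G vw)) hw hv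

    colour-isCFON : IsCFON G 3 colour
    colour-isCFON v with v ≟ x
    ... | yes refl = B , x-sees-u
    ... | no v≢x with part v ℕ.≟ part u
    ...   | yes e with v ≟ u
    ...     | yes refl = A , u-sees-x
    ...     | no v≢u   = B , ownClass-sees-u v≢x e v≢u
    colour-isCFON v | no v≢x | no ne with hub (part v) in hv
    ...     | nothing = A , hubless-sees-x v≢x hv
    ...     | just t with v ≟ t
    ...       | yes refl = A , hub-sees-relay ne hv
    ...       | no v≢t   = B , sees-hub v≢x ne hv v≢t

lemma3 : ∀ (n : ℕ) (G : Graph n) → 2 ≤ n → Connected G →
         (x : Fin n) → DisjointUnionOfCliquesWithout G x →
         χON≤ G 3
lemma3 (suc zero)    G (s≤s ()) connected x _
lemma3 (suc (suc m)) G _ connected x (part , cliques)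
  with y , x≢y ← ∃-other x
  with u , xu ← ∃-neighbour G x≢y (connected x y)
  = 3 , ≤-refl , colour , colour-isCFON
  where
  open CliquesBesides G x part cliques
  open Colouring connected u xu
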